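{- For $n\ge1$, $F_n(1;1,1,1,-1)=\sum_{e\in I_n}(-1)^{\mathrm{inv}(e)}$ equals the number of involutions (permutations $\pi$ with $\pi=\pi^{ -1}$) in the symmetric group $\mathfrak S_n$.
   Context: An inversion sequence of length $n$ is a sequence $e=(e_0,\dots,e_{n-1})$ of integers with $0\le e_i\le i$; $I_n$ is the set of them. For $e\in I_n$: $\mathrm{inv}(e)=|\{(i,j):i<j,\ e_i>e_j\}|$, $\mathrm{sum}(e)=\sum_i e_i$, $\mathrm{noz}(e)$ = number of zero entries, $\mathrm{tel}(e)=n-(\text{number of distinct entries of }e)$, $\mathrm{uel}(e)=n-\max(e)-1$. $F_n(x;y,z,p,q)=\sum_{e\in I_n}x^{\mathrm{noz}(e)}y^{\mathrm{tel}(e)}z^{\mathrm{uel}(e)}p^{\mathrm{sum}(e)}q^{\mathrm{inv}(e)}$. -}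

module Defs where

open import Data.Nat using (ℕ; zero; suc; _+_; _<ᵇ_; _≡ᵇ_)
open import Data.Nat.Properties using (_≟_)
open import Data.Bool using (Bool; true; false; if_then_else_; _∧_)
open import Data.Integer using (ℤ; +_; -_; _*_) renaming (_+_ to _+ℤ_)
open import Data.List using (List; []; _∷_; map; concatMap; length; filter; sum; allFin; upTo; foldr; _++_)
open import Data.Fin using (Fin; toℕ)
open import Data.Vec using (Vec; []; _∷_; lookup; tabulate)

-- Inversion sequences of length n, represented as lists e = (e_0,...,e_{n-1})
-- with 0 ≤ e_i ≤ i.  invSeqs n enumerates I_n (each element exactly once):
-- a sequence of length n+1 is a sequence of length n extended by e_n ∈ {0..n}.
invSeqs : ℕ → List (List ℕ)
invSeqs zero = [] ∷ []
invSeqs (suc n) = concatMap (λ e → map (λ k → e ++ (k ∷ [])) (upTo (suc n))) (invSeqs n)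

inv : List ℕ → ℕ
inv [] = 0
inv (x ∷ xs) = length (filter (λ y → y Data.Nat.<? x) xs) + inv xs

signPow : ℕ → ℤ
signPow zero = + 1
signPow (suc k) = - signPow k

Fspec : ℕ → ℤ
Fspec n = foldr _+ℤ_ (+ 0) (map (λ e → signPow (inv e)) (invSeqs n))

allVecs : (n m : ℕ) → List (Vec (Fin m) n)
allVecs zero m = [] ∷ []
allVecs (suc n) m = concatMap (λ v → map (λ k → k ∷ v) (allFin m)) (allVecs n m)

allL : {A : Set} → (A → Bool) → List A → Bool
allL p [] = true
allL p (x ∷ xs) = p x ∧ allL p xs

-- π is an involution: π(π(i)) = i for all i.  Such a map is automatically a
-- bijection, so these are exactly the involutions in S_n.
isInvolution : {n : ℕ} → Vec (Fin n) n → Bool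
isInvolution {n} π = allL (λ i → toℕ (lookup π (lookup π i)) ≡ᵇ toℕ i) (allFin n)

numInvolutions : ℕ → ℕ
numInvolutions n = length (filter (λ π → Data.Bool._≟_ (isInvolution π) true) (allVecs n n))

module Submission where

-- Both sides satisfy a(n+2) = a(n+1) + (n+1)·a(n) with a(0) = a(1) = 1.
--
-- Involutions: split on π(0).  If π fixes 0, deleting 0 leaves an involution
-- of n+1 points.  Otherwise π swaps 0 with one of the n+1 points j; composing
-- with the transposition (0 j) makes both fixed, and deleting them leaves an
-- involution of n points.
--
-- Inversion sequences: appending k to e creates one inversion for every entry
-- of e above k, so (-1)^inv(e k) = (-1)^inv(e) · u_k(e), where u_k(e) is -1 to
-- the number of entries of e above k.  Write an element of I_(n+2) as e j with
-- j ≤ n+1.  The last entry j = n+1 creates no inversion, so these terms give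
-- F(n+1).  The others are e k j with e ∈ I_n and k, j ≤ n; since
-- u_j(e k) = u_j(e) · ε(j,k), where ε(j,k) = -1 if j < k and 1 otherwise, they
-- give Σ_e (-1)^inv(e) · Σ_k Σ_j u_k u_j ε(j,k).  As u² = 1 the off-diagonal
-- terms cancel in pairs, so the double sum is n+1 and these terms give (n+1)·F(n).

open import Defs
open import Data.Nat using (ℕ; _≥_)
open import Data.Integer using (+_)
open import Relation.Binary.PropositionalEquality using (_≡_)

open import Data.Nat as ℕ using (zero; suc; _<_; _<?_)
import Data.Nat.Properties as ℕ
open import Data.Integer as ℤ using (ℤ; -_; _+_; _*_)
import Data.Integer.Properties as ℤ
open import Data.Integer.Tactic.RingSolver using (solve-∀)
open import Data.Bool as Bool using (Bool; true; false; T)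
open import Data.Bool.Properties using (T-≡; T-∧)
open import Data.Unit using (tt)
open import Data.Fin as Fin using (Fin; zero; suc; toℕ; inject₁; punchIn; punchOut; _≟_)
import Data.Fin.Properties as Fin
open import Data.Fin.Permutation using (↔⇒≡)
open import Data.Fin.Permutation.Components using (transpose; transpose-inverse)
open import Data.Vec using (Vec; []; _∷_; lookup; tabulate)
open import Data.Vec.Properties using (lookup∘tabulate; tabulate∘lookup; tabulate-cong; ∷-injective)
open import Data.List as List
  using (List; []; _∷_; [_]; _∷ʳ_; _++_; map; concatMap; cartesianProductWith; filter; length; foldr; applyUpTo; upTo; allFin)
open import Data.List.Properties using (filter-++; length-++; filter-none; map-cong-local; map-∘)
open import Data.List.Membership.Propositional using (_∈_)
open import Data.List.Membership.Propositional.Properties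
  using (∈-filter⁺; ∈-filter⁻; ∈-lookup; ∈-allFin; ∈-cartesianProductWith⁺)
open import Data.List.Relation.Unary.Any using (here; index)
open import Data.List.Relation.Unary.Any.Properties using (lookup-index)
open import Data.List.Relation.Unary.All as All using (All; []; _∷_)
open import Data.List.Relation.Unary.All.Properties using (concat⁺; map⁺; applyUpTo⁺₁; ∷ʳ⁺)
open import Data.List.Relation.Unary.AllPairs using ([]; _∷_)
open import Data.List.Relation.Unary.Unique.Propositional using (Unique)
import Data.List.Relation.Unary.Unique.Propositional.Properties as Unique
open import Data.Product as Product using (Σ; _×_; _,_; proj₁; proj₂)
open import Data.Product.Function.Dependent.Propositional using (Σ-↔)
open import Data.Product.Function.NonDependent.Propositional using (_×-↔_)
open import Data.Sum using (_⊎_; inj₁; inj₂)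
open import Data.Sum.Function.Propositional using (_⊎-↔_)
open import Algebra.Definitions using (Involutive)
open import Algebra.Properties.Semiring.Sum ℤ.+-*-semiring
  using (sum; sum-cong-≗; sum-init-last; ∑-distrib-+; *-distribˡ-sum)
import Algebra.Properties.CommutativeSemigroup as CommutativeSemigroupProperties
open import Function using (_∘_; id; flip; _↔_; mk↔ₛ′; Inverse; Equivalence; Injective)
open import Function.Properties.Inverse using (↔-refl; ↔-trans)
import Function.Related.Propositional as Related
open import Relation.Nullary using (Irrelevant; yes; no; contradiction)
open import Relation.Nullary.Decidable using (dec-true; dec-false)
open import Relation.Unary using (Decidable)
open import Relation.Binary.PropositionalEquality using (_≢_; refl; sym; trans; cong; cong₂; subst; module ≡-Reasoning)
open import Axiom.UniquenessOfIdentityProofs.WithK using (uip)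
open ≡-Reasoning

module ℕ+ = CommutativeSemigroupProperties ℕ.+-commutativeSemigroup
module ℤ+ = CommutativeSemigroupProperties ℤ.+-commutativeSemigroup

signPow-+ : ∀ m n → signPow (m ℕ.+ n) ≡ signPow m * signPow n
signPow-+ zero    n = sym (ℤ.*-identityˡ (signPow n))
signPow-+ (suc m) n = trans (cong -_ (signPow-+ m n)) (ℤ.neg-distribˡ-* (signPow m) (signPow n))

signPow-square : ∀ n → signPow n * signPow n ≡ + 1
signPow-square zero    = refl
signPow-square (suc n) = trans (neg*neg (signPow n)) (signPow-square n)
  where
  neg*neg : ∀ x → (- x) * (- x) ≡ x * x
  neg*neg = solve-∀

sumBelow : ℕ → (ℕ → ℤ) → ℤ
sumBelow n f = sum {n} (f ∘ toℕ)

sumBelow-suc : ∀ n (f : ℕ → ℤ) → sumBelow (suc n) f ≡ sumBelow n f + f n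
sumBelow-suc n f = trans (sum-init-last {n} (f ∘ toℕ))
  (cong₂ _+_ (sum-cong-≗ {n} {f ∘ toℕ ∘ inject₁} {f ∘ toℕ} (cong f ∘ Fin.toℕ-inject₁)) (cong f (Fin.toℕ-fromℕ n)))

sumBelow-cong : ∀ n {f g : ℕ → ℤ} → (∀ k → f k ≡ g k) → sumBelow n f ≡ sumBelow n g
sumBelow-cong n {f} {g} f≗g = sum-cong-≗ {n} {f ∘ toℕ} {g ∘ toℕ} (f≗g ∘ toℕ)

sumOver : {A : Set} → List A → (A → ℤ) → ℤ
sumOver xs f = foldr _+_ (+ 0) (map f xs)

sumOver-++ : {A : Set} (xs ys : List A) (f : A → ℤ) → sumOver (xs ++ ys) f ≡ sumOver xs f + sumOver ys f
sumOver-++ []       ys f = sym (ℤ.+-identityˡ (sumOver ys f))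
sumOver-++ (x ∷ xs) ys f = trans (cong (_+_ (f x)) (sumOver-++ xs ys f)) (sym (ℤ.+-assoc (f x) _ _))

sumOver-concatMap : {A B : Set} (g : A → List B) (xs : List A) (f : B → ℤ) →
                    sumOver (concatMap g xs) f ≡ sumOver xs (λ x → sumOver (g x) f)
sumOver-concatMap g []       f = refl
sumOver-concatMap g (x ∷ xs) f =
  trans (sumOver-++ (g x) (concatMap g xs) f) (cong (_+_ (sumOver (g x) f)) (sumOver-concatMap g xs f))

sumOver-map : {A B : Set} (g : A → B) (xs : List A) (f : B → ℤ) → sumOver (map g xs) f ≡ sumOver xs (f ∘ g)
sumOver-map g xs f = cong (foldr _+_ (+ 0)) (sym (map-∘ xs))

sumOver-applyUpTo : ∀ (g : ℕ → ℕ) n (f : ℕ → ℤ) → sumOver (applyUpTo g n) f ≡ sumBelow n (f ∘ g)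
sumOver-applyUpTo g zero    f = refl
sumOver-applyUpTo g (suc n) f = cong (_+_ (f (g 0))) (sumOver-applyUpTo (g ∘ suc) n f)

sumOver-cong : {A : Set} (xs : List A) {f g : A → ℤ} → All (λ x → f x ≡ g x) xs → sumOver xs f ≡ sumOver xs g
sumOver-cong xs f≗g = cong (foldr _+_ (+ 0)) (map-cong-local f≗g)

sumOver-+ : {A : Set} (xs : List A) (f g : A → ℤ) → sumOver xs (λ x → f x + g x) ≡ sumOver xs f + sumOver xs g
sumOver-+ []       f g = refl
sumOver-+ (x ∷ xs) f g = trans (cong (_+_ (f x + g x)) (sumOver-+ xs f g)) (ℤ+.interchange (f x) (g x) _ _)

sumOver-*ʳ : {A : Set} (xs : List A) (f : A → ℤ) (c : ℤ) → sumOver xs (λ x → f x * c) ≡ sumOver xs f * c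
sumOver-*ʳ []       f c = sym (ℤ.*-zeroˡ c)
sumOver-*ʳ (x ∷ xs) f c = trans (cong (_+_ (f x * c)) (sumOver-*ʳ xs f c)) (sym (ℤ.*-distribʳ-+ c (f x) _))

-- Signs of inversion sequences

length-filter-++ : {A : Set} {P : A → Set} (P? : Decidable P) (xs ys : List A) →
                   length (filter P? (xs ++ ys)) ≡ length (filter P? xs) ℕ.+ length (filter P? ys)
length-filter-++ P? xs ys = trans (cong length (filter-++ P? xs ys)) (length-++ (filter P? xs))

countAbove : ℕ → List ℕ → ℕ
countAbove j e = length (filter (j <?_) e)

singleton-below≡above : ∀ x k → length (filter (_<? x) [ k ]) ≡ countAbove k [ x ]
singleton-below≡above x k with k ℕ.<ᵇ x
... | true  = refl
... | false = refl

inv-∷ʳ : ∀ e k → inv (e ∷ʳ k) ≡ inv e ℕ.+ countAbove k e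
inv-∷ʳ []      k = refl
inv-∷ʳ (x ∷ e) k = begin
  below (e ∷ʳ k) ℕ.+ inv (e ∷ʳ k)
    ≡⟨ cong₂ ℕ._+_ (length-filter-++ (_<? x) e [ k ]) (inv-∷ʳ e k) ⟩
  (below e ℕ.+ below [ k ]) ℕ.+ (inv e ℕ.+ countAbove k e)
    ≡⟨ ℕ+.interchange (below e) (below [ k ]) (inv e) (countAbove k e) ⟩
  (below e ℕ.+ inv e) ℕ.+ (below [ k ] ℕ.+ countAbove k e)
    ≡⟨ cong (λ c → below e ℕ.+ inv e ℕ.+ (c ℕ.+ countAbove k e)) (singleton-below≡above x k) ⟩
  (below e ℕ.+ inv e) ℕ.+ (countAbove k [ x ] ℕ.+ countAbove k e)
    ≡⟨ cong (below e ℕ.+ inv e ℕ.+_) (length-filter-++ (k <?_) [ x ] e) ⟨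
  (below e ℕ.+ inv e) ℕ.+ countAbove k (x ∷ e) ∎
  where
  below : List ℕ → ℕ
  below = length ∘ filter (_<? x)

invSign : List ℕ → ℤ
invSign e = signPow (inv e)

aboveSign : ℕ → List ℕ → ℤ
aboveSign j e = signPow (countAbove j e)

crossSign : ℕ → ℕ → ℤ
crossSign _       zero    = + 1
crossSign zero    (suc _) = - + 1
crossSign (suc j) (suc k) = crossSign j k

aboveSign-singleton : ∀ j k → aboveSign j [ k ] ≡ crossSign j k
aboveSign-singleton j       zero    = refl
aboveSign-singleton zero    (suc k) = refl
aboveSign-singleton (suc j) (suc k) = trans (cong signPow countAbove-suc) (aboveSign-singleton j k)
  where
  countAbove-suc : countAbove (suc j) [ suc k ] ≡ countAbove j [ k ]
  countAbove-suc with j ℕ.<ᵇ k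
  ... | true  = refl
  ... | false = refl

invSign-∷ʳ : ∀ e k → invSign (e ∷ʳ k) ≡ invSign e * aboveSign k e
invSign-∷ʳ e k = trans (cong signPow (inv-∷ʳ e k)) (signPow-+ (inv e) (countAbove k e))

aboveSign-∷ʳ : ∀ j e k → aboveSign j (e ∷ʳ k) ≡ aboveSign j e * crossSign j k
aboveSign-∷ʳ j e k = begin
  signPow (countAbove j (e ∷ʳ k))                 ≡⟨ cong signPow (length-filter-++ (j <?_) e [ k ]) ⟩
  signPow (countAbove j e ℕ.+ countAbove j [ k ]) ≡⟨ signPow-+ (countAbove j e) (countAbove j [ k ]) ⟩
  aboveSign j e * aboveSign j [ k ]               ≡⟨ cong (aboveSign j e *_) (aboveSign-singleton j k) ⟩
  aboveSign j e * crossSign j k                   ∎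

aboveSign-bounded : ∀ {j e} → All (_< j) e → aboveSign j e ≡ + 1
aboveSign-bounded {j} e<j = cong (signPow ∘ length) (filter-none (j <?_) (All.map ℕ.<⇒≯ e<j))

invSeqs-bounded : ∀ n → All (All (_< n)) (invSeqs n)
invSeqs-bounded zero    = [] ∷ []
invSeqs-bounded (suc n) = concat⁺ (map⁺ (All.map extensions-bounded (invSeqs-bounded n)))
  where
  extensions-bounded : ∀ {e} → All (_< n) e → All (All (_< suc n)) (map (e ∷ʳ_) (upTo (suc n)))
  extensions-bounded e<n = map⁺ (applyUpTo⁺₁ id (suc n) (∷ʳ⁺ (All.map ℕ.m<n⇒m<1+n e<n)))

-- Peeling off k = 0 and j = 0: row 0 contributes u₀² + u₀·Σv, column 0 contributes −u₀·Σv.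
sumBelow-crossSign : ∀ N (u : ℕ → ℤ) → (∀ k → u k * u k ≡ + 1) →
                     sumBelow N (λ k → u k * sumBelow N (λ j → u j * crossSign j k)) ≡ + N
sumBelow-crossSign zero    u u²≡1 = refl
sumBelow-crossSign (suc N) u u²≡1 = begin
  u 0 * (u 0 * + 1 + sumBelow N (λ j → v j * + 1)) + sumBelow N (λ k → v k * (u 0 * - + 1 + row k))
    ≡⟨ cong₂ (λ s t → u 0 * (u 0 * + 1 + s) + t) (sumBelow-cong N (ℤ.*-identityʳ ∘ v)) lowerRows ⟩
  u 0 * (u 0 * + 1 + sumBelow N v) + (- u 0 * sumBelow N v + sumBelow N (λ k → v k * row k))
    ≡⟨ cancel (u 0) (sumBelow N v) _ ⟩
  u 0 * u 0 + sumBelow N (λ k → v k * row k)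
    ≡⟨ cong₂ _+_ (u²≡1 0) (sumBelow-crossSign N v (u²≡1 ∘ suc)) ⟩
  + suc N ∎
  where
  v : ℕ → ℤ
  v = u ∘ suc
  row : ℕ → ℤ
  row k = sumBelow N (λ j → v j * crossSign j k)
  expand : ∀ a b x → a * (b * - + 1 + x) ≡ - b * a + a * x
  expand = solve-∀
  cancel : ∀ a s d → a * (a * + 1 + s) + (- a * s + d) ≡ a * a + d
  cancel = solve-∀
  lowerRows : sumBelow N (λ k → v k * (u 0 * - + 1 + row k)) ≡ - u 0 * sumBelow N v + sumBelow N (λ k → v k * row k)
  lowerRows = begin
    sumBelow N (λ k → v k * (u 0 * - + 1 + row k))
      ≡⟨ sumBelow-cong N (λ k → expand (v k) (u 0) (row k)) ⟩
    sumBelow N (λ k → - u 0 * v k + v k * row k)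
      ≡⟨ ∑-distrib-+ {N} (λ i → - u 0 * v (toℕ i)) (λ i → v (toℕ i) * row (toℕ i)) ⟩
    sumBelow N (λ k → - u 0 * v k) + sumBelow N (λ k → v k * row k)
      ≡⟨ cong (_+ sumBelow N (λ k → v k * row k)) (*-distribˡ-sum {N} (- u 0) (v ∘ toℕ)) ⟨
    - u 0 * sumBelow N v + sumBelow N (λ k → v k * row k) ∎

sumOver-invSeqs-suc : ∀ n (f : List ℕ → ℤ) →
                      sumOver (invSeqs (suc n)) f ≡ sumOver (invSeqs n) (λ e → sumBelow (suc n) (λ k → f (e ∷ʳ k)))
sumOver-invSeqs-suc n f =
  trans (sumOver-concatMap _ (invSeqs n) f) (sumOver-cong (invSeqs n) (All.universal extensions (invSeqs n)))
  where
  extensions : ∀ e → sumOver (map (e ∷ʳ_) (upTo (suc n))) f ≡ sumBelow (suc n) (λ k → f (e ∷ʳ k))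
  extensions e = trans (sumOver-map (e ∷ʳ_) (upTo (suc n)) f) (sumOver-applyUpTo id (suc n) (f ∘ (e ∷ʳ_)))

sumBelow-sumBelow-invSign-∷ʳ-∷ʳ : ∀ N e →
                                  sumBelow N (λ k → sumBelow N (λ j → invSign (e ∷ʳ k ∷ʳ j))) ≡ invSign e * + N
sumBelow-sumBelow-invSign-∷ʳ-∷ʳ N e = begin
  sumBelow N (λ k → sumBelow N (λ j → invSign (e ∷ʳ k ∷ʳ j)))
    ≡⟨ sumBelow-cong N (λ k → sumBelow-cong N (invSign-∷ʳ-∷ʳ k)) ⟩
  sumBelow N (λ k → sumBelow N (λ j → (invSign e * u k) * (u j * crossSign j k)))
    ≡⟨ sumBelow-cong N (λ k → *-distribˡ-sum {N} (invSign e * u k) (λ i → u (toℕ i) * crossSign (toℕ i) k)) ⟨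
  sumBelow N (λ k → (invSign e * u k) * row k)
    ≡⟨ sumBelow-cong N (λ k → ℤ.*-assoc (invSign e) (u k) (row k)) ⟩
  sumBelow N (λ k → invSign e * (u k * row k))
    ≡⟨ *-distribˡ-sum {N} (invSign e) (λ i → u (toℕ i) * row (toℕ i)) ⟨
  invSign e * sumBelow N (λ k → u k * row k)
    ≡⟨ cong (invSign e *_) (sumBelow-crossSign N u (λ k → signPow-square (countAbove k e))) ⟩
  invSign e * + N ∎
  where
  u : ℕ → ℤ
  u j = aboveSign j e
  row : ℕ → ℤ
  row k = sumBelow N (λ j → u j * crossSign j k)
  invSign-∷ʳ-∷ʳ : ∀ k j → invSign (e ∷ʳ k ∷ʳ j) ≡ (invSign e * u k) * (u j * crossSign j k)
  invSign-∷ʳ-∷ʳ k j = trans (invSign-∷ʳ (e ∷ʳ k) j) (cong₂ _*_ (invSign-∷ʳ e k) (aboveSign-∷ʳ j e k))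

extensionSum : ℕ → ℕ → ℤ
extensionSum n m = sumOver (invSeqs n) (λ e → sumBelow m (λ k → invSign (e ∷ʳ k)))

Fspec-suc : ∀ n → Fspec (suc n) ≡ extensionSum n (suc n)
Fspec-suc n = sumOver-invSeqs-suc n invSign

extensionSum-suc : ∀ n → extensionSum n (suc n) ≡ extensionSum n n + Fspec n
extensionSum-suc n = trans (sumOver-cong (invSeqs n) (All.map lastEntry (invSeqs-bounded n)))
                           (sumOver-+ (invSeqs n) (λ e → sumBelow n (λ k → invSign (e ∷ʳ k))) invSign)
  where
  lastEntry : ∀ {e} → All (_< n) e →
              sumBelow (suc n) (λ k → invSign (e ∷ʳ k)) ≡ sumBelow n (λ k → invSign (e ∷ʳ k)) + invSign e
  lastEntry {e} e<n = begin
    sumBelow (suc n) (λ k → invSign (e ∷ʳ k))   ≡⟨ sumBelow-suc n (λ k → invSign (e ∷ʳ k)) ⟩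
    lower + invSign (e ∷ʳ n)                    ≡⟨ cong (_+_ lower) (invSign-∷ʳ e n) ⟩
    lower + invSign e * aboveSign n e           ≡⟨ cong (λ s → lower + invSign e * s) (aboveSign-bounded e<n) ⟩
    lower + invSign e * + 1                     ≡⟨ cong (_+_ lower) (ℤ.*-identityʳ (invSign e)) ⟩
    lower + invSign e                           ∎
    where
    lower : ℤ
    lower = sumBelow n (λ k → invSign (e ∷ʳ k))

extensionSum-diagonal : ∀ n → extensionSum (suc n) (suc n) ≡ Fspec n * + suc n
extensionSum-diagonal n = begin
  extensionSum (suc n) (suc n)
    ≡⟨ sumOver-invSeqs-suc n _ ⟩
  sumOver (invSeqs n) (λ e → sumBelow (suc n) (λ k → sumBelow (suc n) (λ j → invSign (e ∷ʳ k ∷ʳ j))))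
    ≡⟨ sumOver-cong (invSeqs n) (All.universal (sumBelow-sumBelow-invSign-∷ʳ-∷ʳ (suc n)) (invSeqs n)) ⟩
  sumOver (invSeqs n) (λ e → invSign e * + suc n)
    ≡⟨ sumOver-*ʳ (invSeqs n) invSign (+ suc n) ⟩
  Fspec n * + suc n ∎

Fspec-suc-suc : ∀ n → Fspec (suc (suc n)) ≡ Fspec (suc n) + + suc n * Fspec n
Fspec-suc-suc n = begin
  Fspec (suc (suc n))                          ≡⟨ Fspec-suc (suc n) ⟩
  extensionSum (suc n) (suc (suc n))           ≡⟨ extensionSum-suc (suc n) ⟩
  extensionSum (suc n) (suc n) + Fspec (suc n) ≡⟨ cong (_+ Fspec (suc n)) (extensionSum-diagonal n) ⟩
  Fspec n * + suc n + Fspec (suc n)            ≡⟨ ℤ.+-comm (Fspec n * + suc n) (Fspec (suc n)) ⟩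
  Fspec (suc n) + Fspec n * + suc n            ≡⟨ cong (_+_ (Fspec (suc n))) (ℤ.*-comm (Fspec n) (+ suc n)) ⟩
  Fspec (suc n) + + suc n * Fspec n            ∎

Σ-≡-irrelevant : {A : Set} {P : A → Set} → (∀ {x} → Irrelevant (P x)) → {u v : Σ A P} → proj₁ u ≡ proj₁ v → u ≡ v
Σ-≡-irrelevant irr {_ , p} {_ , q} refl = cong (_ ,_) (irr p q)

lookup-injective : {A : Set} {xs : List A} → Unique xs → ∀ {i j} → List.lookup xs i ≡ List.lookup xs j → i ≡ j
lookup-injective {xs = _ ∷ _} _            {zero}  {zero}  _  = refl
lookup-injective {xs = _ ∷ _} (x∉xs ∷ _)   {zero}  {suc j} eq = contradiction eq (All.lookup x∉xs (∈-lookup j))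
lookup-injective {xs = _ ∷ _} (x∉xs ∷ _)   {suc i} {zero}  eq = contradiction (sym eq) (All.lookup x∉xs (∈-lookup i))
lookup-injective {xs = _ ∷ _} (_ ∷ unique) {suc i} {suc j} eq = cong suc (lookup-injective unique eq)

Fin-length↔ : {A : Set} {P : A → Set} {xs : List A} → Unique xs → (∀ {x} → Irrelevant (P x)) →
              (∀ {x} → x ∈ xs → P x) → (∀ {x} → P x → x ∈ xs) → Fin (length xs) ↔ Σ A P
Fin-length↔ {A = A} {P} {xs} unique irr sound complete = mk↔ₛ′ to from to∘from from∘to
  where
  to : Fin (length xs) → Σ A P
  to i = List.lookup xs i , sound (∈-lookup i)
  from : Σ A P → Fin (length xs)
  from (_ , p) = index (complete p)
  to∘from : ∀ x → to (from x) ≡ x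
  to∘from (_ , p) = Σ-≡-irrelevant irr (sym (lookup-index (complete p)))
  from∘to : ∀ i → from (to i) ≡ i
  from∘to i = lookup-injective unique (sym (lookup-index (complete (sound (∈-lookup i)))))

Fin-length-filter↔ : {A : Set} {P : A → Set} (P? : Decidable P) {xs : List A} → Unique xs → (∀ x → x ∈ xs) →
                     (∀ {x} → Irrelevant (P x)) → Fin (length (filter P? xs)) ↔ Σ A P
Fin-length-filter↔ P? {xs} unique complete irr =
  Fin-length↔ (Unique.filter⁺ P? unique) irr (proj₂ ∘ ∈-filter⁻ P? {xs = xs}) (∈-filter⁺ P? (complete _))

concatMap-map≡cartesianProductWith : {A B C : Set} (f : A → B → C) (xs : List A) (ys : List B) →
                                     concatMap (λ x → map (f x) ys) xs ≡ cartesianProductWith f xs ys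
concatMap-map≡cartesianProductWith f []       ys = refl
concatMap-map≡cartesianProductWith f (x ∷ xs) ys = cong (map (f x) ys ++_) (concatMap-map≡cartesianProductWith f xs ys)

allVecs-unique : ∀ n m → Unique (allVecs n m)
allVecs-unique zero    m = [] ∷ []
allVecs-unique (suc n) m =
  subst Unique (sym (concatMap-map≡cartesianProductWith (flip _∷_) (allVecs n m) (allFin m)))
    (Unique.cartesianProductWith⁺ (flip _∷_) (Product.swap ∘ ∷-injective) (allVecs-unique n m) (Unique.allFin⁺ m))

allVecs-complete : ∀ n m (v : Vec (Fin m) n) → v ∈ allVecs n m
allVecs-complete zero    m []      = here refl
allVecs-complete (suc n) m (k ∷ v) =
  subst (k ∷ v ∈_) (sym (concatMap-map≡cartesianProductWith (flip _∷_) (allVecs n m) (allFin m)))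
    (∈-cartesianProductWith⁺ (flip _∷_) (allVecs-complete n m v) (∈-allFin k))

fibres↔ : {A : Set} {m : ℕ} (h : A → Fin (suc m)) →
          A ↔ (Σ A (λ x → h x ≡ zero) ⊎ Σ (Fin m) (λ j → Σ A (λ x → h x ≡ suc j)))
fibres↔ {A} {m} h = mk↔ₛ′ (λ x → split x (h x) refl) from to∘from (λ x → from-split x (h x) refl)
  where
  split : ∀ x v → h x ≡ v → Σ A (λ x → h x ≡ zero) ⊎ Σ (Fin m) (λ j → Σ A (λ x → h x ≡ suc j))
  split x zero    hx≡v = inj₁ (x , hx≡v)
  split x (suc j) hx≡v = inj₂ (j , x , hx≡v)
  from : Σ A (λ x → h x ≡ zero) ⊎ Σ (Fin m) (λ j → Σ A (λ x → h x ≡ suc j)) → A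
  from (inj₁ (x , _))     = x
  from (inj₂ (_ , x , _)) = x
  split-canonical : ∀ x v (hx≡v : h x ≡ v) → split x (h x) refl ≡ split x v hx≡v
  split-canonical x _ refl = refl
  to∘from : ∀ y → split (from y) (h (from y)) refl ≡ y
  to∘from (inj₁ (x , hx≡0))       = split-canonical x zero hx≡0
  to∘from (inj₂ (j , x , hx≡1+j)) = split-canonical x (suc j) hx≡1+j
  from-split : ∀ x v (hx≡v : h x ≡ v) → from (split x v hx≡v) ≡ x
  from-split x zero    _ = refl
  from-split x (suc j) _ = refl

Σ-↔-restrict : {A B : Set} {P : A → Set} {Q : B → Set} (f : A ↔ B) →
               (∀ {x} → Irrelevant (P x)) → (∀ {y} → Irrelevant (Q y)) →
               (∀ {x} → P x → Q (Inverse.to f x)) → (∀ {y} → Q y → P (Inverse.from f y)) → Σ A P ↔ Σ B Q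
Σ-↔-restrict f irrP irrQ P⇒Q Q⇒P = mk↔ₛ′
  (λ (x , p) → Inverse.to f x , P⇒Q p)
  (λ (y , q) → Inverse.from f y , Q⇒P q)
  (λ (y , _) → Σ-≡-irrelevant irrQ (Inverse.strictlyInverseˡ f y))
  (λ (x , _) → Σ-≡-irrelevant irrP (Inverse.strictlyInverseʳ f x))

punchOut-≡ : ∀ {n} (a : Fin (suc n)) {x} (a≢x : a ≢ x) {j} → x ≡ punchIn a j → punchOut a≢x ≡ j
punchOut-≡ a _ x≡a+j = trans (Fin.punchOut-cong a x≡a+j) (Fin.punchOut-punchIn a)

data PunchInView {n} (a : Fin (suc n)) : Fin (suc n) → Set where
  at      : PunchInView a a
  punched : ∀ j → PunchInView a (punchIn a j)

punchInView : ∀ {n} (a x : Fin (suc n)) → PunchInView a x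
punchInView a x with a ≟ x
... | yes refl = at
... | no  a≢x  = subst (PunchInView a) (Fin.punchIn-punchOut a≢x) (punched (punchOut a≢x))

data Position {n} (a b : Fin n) : Fin n → Set where
  atˡ  : Position a b a
  atʳ  : Position a b b
  away : ∀ {x} → x ≢ a → x ≢ b → Position a b x

position : ∀ {n} (a b x : Fin n) → Position a b x
position a b x with x ≟ a | x ≟ b
... | yes refl | _        = atˡ
... | no  _    | yes refl = atʳ
... | no  x≢a  | no  x≢b  = away x≢a x≢b

transpose-matchˡ : ∀ {n} (a b : Fin n) → transpose a b a ≡ b
transpose-matchˡ a b rewrite dec-true (a ≟ a) refl = refl

transpose-matchʳ : ∀ {n} (a b : Fin n) → transpose a b b ≡ a
transpose-matchʳ a b with b ≟ a
... | yes b≡a = b≡a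
... | no  _   rewrite dec-true (b ≟ b) refl = refl

transpose-away : ∀ {n} {a b x : Fin n} → x ≢ a → x ≢ b → transpose a b x ≡ x
transpose-away {a = a} {b} {x} x≢a x≢b rewrite dec-false (x ≟ a) x≢a | dec-false (x ≟ b) x≢b = refl

transpose-involutive : ∀ {n} (a b : Fin n) → Involutive _≡_ (transpose a b)
transpose-involutive a b x with position a b x
... | atˡ          = trans (cong (transpose a b) (transpose-matchˡ a b)) (transpose-matchʳ a b)
... | atʳ          = trans (cong (transpose a b) (transpose-matchʳ a b)) (transpose-matchˡ a b)
... | away x≢a x≢b = trans (cong (transpose a b) (transpose-away x≢a x≢b)) (transpose-away x≢a x≢b)

transpose-conjugate : ∀ {n} {f : Fin n → Fin n} → Injective _≡_ _≡_ f →
                      ∀ a b x → f (transpose a b x) ≡ transpose (f a) (f b) (f x)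
transpose-conjugate {f = f} f-injective a b x with position a b x
... | atˡ          = trans (cong f (transpose-matchˡ a b)) (sym (transpose-matchˡ (f a) (f b)))
... | atʳ          = trans (cong f (transpose-matchʳ a b)) (sym (transpose-matchʳ (f a) (f b)))
... | away x≢a x≢b =
  trans (cong f (transpose-away x≢a x≢b)) (sym (transpose-away (x≢a ∘ f-injective) (x≢b ∘ f-injective)))

-- Involutions

allL-sound : {A : Set} (p : A → Bool) (xs : List A) → T (allL p xs) → All (T ∘ p) xs
allL-sound p []       _   = []
allL-sound p (x ∷ xs) px∧ = proj₁ (Equivalence.to T-∧ px∧) ∷ allL-sound p xs (proj₂ (Equivalence.to T-∧ px∧))

allL-complete : {A : Set} (p : A → Bool) {xs : List A} → All (T ∘ p) xs → T (allL p xs)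
allL-complete p []         = tt
allL-complete p (px ∷ pxs) = Equivalence.from T-∧ (px , allL-complete p pxs)

isInvolution⇒involutive : ∀ {n} (π : Vec (Fin n) n) → isInvolution π ≡ true → Involutive _≡_ (lookup π)
isInvolution⇒involutive {n} π isInv i =
  Fin.toℕ-injective (ℕ.≡ᵇ⇒≡ _ _ (All.lookup (allL-sound _ (allFin n) (Equivalence.from T-≡ isInv)) (∈-allFin i)))

involutive⇒isInvolution : ∀ {n} (π : Vec (Fin n) n) → Involutive _≡_ (lookup π) → isInvolution π ≡ true
involutive⇒isInvolution {n} π involutive =
  Equivalence.to T-≡ (allL-complete _ (All.universal (λ i → ℕ.≡⇒≡ᵇ _ _ (cong toℕ (involutive i))) (allFin n)))

-- The witness is the Boolean test rather than Involutive, because it is proof-irrelevant (by K):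
-- two involutions are equal as soon as their vectors are.
Involution : ℕ → Set
Involution n = Σ (Vec (Fin n) n) (λ π → isInvolution π ≡ true)

Fin-numInvolutions↔ : ∀ n → Fin (numInvolutions n) ↔ Involution n
Fin-numInvolutions↔ n =
  Fin-length-filter↔ (λ π → isInvolution π Bool.≟ true) (allVecs-unique n n) (allVecs-complete n n) uip

infixl 9 _⟨$⟩_

_⟨$⟩_ : ∀ {n} → Involution n → Fin n → Fin n
π ⟨$⟩ i = lookup (proj₁ π) i

⟨$⟩-involutive : ∀ {n} (π : Involution n) → Involutive _≡_ (π ⟨$⟩_)
⟨$⟩-involutive (π , isInv) = isInvolution⇒involutive π isInv

⟨$⟩-injective : ∀ {n} (π : Involution n) → Injective _≡_ _≡_ (π ⟨$⟩_)
⟨$⟩-injective π {x} {y} πx≡πy =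
  trans (sym (⟨$⟩-involutive π x)) (trans (cong (π ⟨$⟩_) πx≡πy) (⟨$⟩-involutive π y))

involution : ∀ {n} (f : Fin n → Fin n) → Involutive _≡_ f → Involution n
involution f f-involutive = tabulate f , involutive⇒isInvolution (tabulate f) (λ i → begin
  lookup (tabulate f) (lookup (tabulate f) i) ≡⟨ cong (lookup (tabulate f)) (lookup∘tabulate f i) ⟩
  lookup (tabulate f) (f i)                   ≡⟨ lookup∘tabulate f (f i) ⟩
  f (f i)                                     ≡⟨ f-involutive i ⟩
  i                                           ∎)

involution-⟨$⟩ : ∀ {n} (f : Fin n → Fin n) (f-involutive : Involutive _≡_ f) i → involution f f-involutive ⟨$⟩ i ≡ f i
involution-⟨$⟩ f _ = lookup∘tabulate f

Involution-≡ : ∀ {n} {π ρ : Involution n} → (∀ i → π ⟨$⟩ i ≡ ρ ⟨$⟩ i) → π ≡ ρ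
Involution-≡ {π = π , _} {ρ , _} π≗ρ =
  Σ-≡-irrelevant uip (trans (sym (tabulate∘lookup π)) (trans (tabulate-cong π≗ρ) (tabulate∘lookup ρ)))

Fixing : ∀ {n} → Fin n → Involution n → Set
Fixing a π = π ⟨$⟩ a ≡ a

module _ {n} (a : Fin (suc n)) (π : Involution (suc n)) (πa≡a : Fixing a π) where

  private
    avoids : ∀ i → a ≢ π ⟨$⟩ punchIn a i
    avoids i a≡π[a+i] = Fin.punchInᵢ≢i a i (begin
      punchIn a i               ≡⟨ ⟨$⟩-involutive π (punchIn a i) ⟨
      π ⟨$⟩ (π ⟨$⟩ punchIn a i) ≡⟨ cong (π ⟨$⟩_) a≡π[a+i] ⟨
      π ⟨$⟩ a                   ≡⟨ πa≡a ⟩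
      a                         ∎)

    restriction : Fin n → Fin n
    restriction i = punchOut (avoids i)

    restriction-involutive : Involutive _≡_ restriction
    restriction-involutive i = punchOut-≡ a (avoids (restriction i)) (begin
      π ⟨$⟩ punchIn a (restriction i) ≡⟨ cong (π ⟨$⟩_) (Fin.punchIn-punchOut (avoids i)) ⟩
      π ⟨$⟩ (π ⟨$⟩ punchIn a i)       ≡⟨ ⟨$⟩-involutive π (punchIn a i) ⟩
      punchIn a i                     ∎)

  removeFixedPoint : Involution n
  removeFixedPoint = involution restriction restriction-involutive

  punchIn-removeFixedPoint : ∀ i → punchIn a (removeFixedPoint ⟨$⟩ i) ≡ π ⟨$⟩ punchIn a i
  punchIn-removeFixedPoint i =
    trans (cong (punchIn a) (involution-⟨$⟩ restriction restriction-involutive i)) (Fin.punchIn-punchOut (avoids i))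

module _ {n} (a : Fin (suc n)) (σ : Involution n) where

  private
    extension : Fin (suc n) → Fin (suc n)
    extension x with a ≟ x
    ... | yes _   = a
    ... | no  a≢x = punchIn a (σ ⟨$⟩ punchOut a≢x)

    extension-at : extension a ≡ a
    extension-at with a ≟ a
    ... | yes _   = refl
    ... | no  a≢a = contradiction refl a≢a

    extension-punchIn : ∀ j → extension (punchIn a j) ≡ punchIn a (σ ⟨$⟩ j)
    extension-punchIn j with a ≟ punchIn a j
    ... | yes a≡a+j = contradiction (sym a≡a+j) (Fin.punchInᵢ≢i a j)
    ... | no  a≢a+j = cong (λ i → punchIn a (σ ⟨$⟩ i)) (punchOut-≡ a a≢a+j refl)

    extension-involutive : Involutive _≡_ extension
    extension-involutive x with punchInView a x
    ... | at        = trans (cong extension extension-at) extension-at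
    ... | punched j = begin
      extension (extension (punchIn a j)) ≡⟨ cong extension (extension-punchIn j) ⟩
      extension (punchIn a (σ ⟨$⟩ j))     ≡⟨ extension-punchIn (σ ⟨$⟩ j) ⟩
      punchIn a (σ ⟨$⟩ (σ ⟨$⟩ j))         ≡⟨ cong (punchIn a) (⟨$⟩-involutive σ j) ⟩
      punchIn a j                         ∎

  insertFixedPoint : Involution (suc n)
  insertFixedPoint = involution extension extension-involutive

  insertFixedPoint-at : Fixing a insertFixedPoint
  insertFixedPoint-at = trans (involution-⟨$⟩ extension extension-involutive a) extension-at

  insertFixedPoint-punchIn : ∀ j → insertFixedPoint ⟨$⟩ punchIn a j ≡ punchIn a (σ ⟨$⟩ j)
  insertFixedPoint-punchIn j =
    trans (involution-⟨$⟩ extension extension-involutive (punchIn a j)) (extension-punchIn j)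

removeFixedPoint↔ : ∀ {n} (a : Fin (suc n)) → Σ (Involution (suc n)) (Fixing a) ↔ Involution n
removeFixedPoint↔ a = mk↔ₛ′
  (λ (π , πa≡a) → removeFixedPoint a π πa≡a)
  (λ σ → insertFixedPoint a σ , insertFixedPoint-at a σ)
  (λ σ → Involution-≡ (remove∘insert σ))
  (λ (π , πa≡a) → Σ-≡-irrelevant uip (Involution-≡ (insert∘remove π πa≡a)))
  where
  remove∘insert : ∀ σ i → removeFixedPoint a (insertFixedPoint a σ) (insertFixedPoint-at a σ) ⟨$⟩ i ≡ σ ⟨$⟩ i
  remove∘insert σ i = Fin.punchIn-injective a _ _
    (trans (punchIn-removeFixedPoint a (insertFixedPoint a σ) (insertFixedPoint-at a σ) i) (insertFixedPoint-punchIn a σ i))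
  insert∘remove : ∀ π πa≡a x → insertFixedPoint a (removeFixedPoint a π πa≡a) ⟨$⟩ x ≡ π ⟨$⟩ x
  insert∘remove π πa≡a x with punchInView a x
  ... | at        = trans (insertFixedPoint-at a _) (sym πa≡a)
  ... | punched j = trans (insertFixedPoint-punchIn a _ j) (punchIn-removeFixedPoint a π πa≡a j)

removeFixedPoint-fixing↔ : ∀ {n} (a : Fin (suc n)) (b : Fin n) →
                           Σ (Σ (Involution (suc n)) (Fixing a)) (Fixing (punchIn a b) ∘ proj₁) ↔ Σ (Involution n) (Fixing b)
removeFixedPoint-fixing↔ a b = Σ-↔-restrict (removeFixedPoint↔ a) uip uip
  (λ {(π , πa≡a)} π[a+b]≡a+b → Fin.punchIn-injective a _ _ (trans (punchIn-removeFixedPoint a π πa≡a b) π[a+b]≡a+b))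
  (λ {σ} σb≡b → trans (insertFixedPoint-punchIn a σ b) (cong (punchIn a) σb≡b))

module _ {n} (a b : Fin n) where

  private
    transposed : Vec (Fin n) n → Vec (Fin n) n
    transposed π = tabulate (λ x → lookup π (transpose a b x))

    lookup-transposed : ∀ π x → lookup (transposed π) x ≡ lookup π (transpose a b x)
    lookup-transposed π = lookup∘tabulate (λ x → lookup π (transpose a b x))

    transposed-twice : ∀ π x → lookup (transposed (transposed π)) x ≡ lookup π x
    transposed-twice π x = begin
      lookup (transposed (transposed π)) x       ≡⟨ lookup-transposed (transposed π) x ⟩
      lookup (transposed π) (transpose a b x)    ≡⟨ lookup-transposed π (transpose a b x) ⟩
      lookup π (transpose a b (transpose a b x)) ≡⟨ cong (lookup π) (transpose-involutive a b x) ⟩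
      lookup π x                                 ∎

    composeTranspose : (π : Involution n) → (∀ x → transpose (π ⟨$⟩ a) (π ⟨$⟩ b) (transpose a b x) ≡ x) → Involution n
    composeTranspose π cancels = involution (λ x → π ⟨$⟩ transpose a b x) (λ x → begin
      π ⟨$⟩ transpose a b (π ⟨$⟩ transpose a b x)
        ≡⟨ transpose-conjugate (⟨$⟩-injective π) a b _ ⟩
      transpose (π ⟨$⟩ a) (π ⟨$⟩ b) (π ⟨$⟩ (π ⟨$⟩ transpose a b x))
        ≡⟨ cong (transpose (π ⟨$⟩ a) (π ⟨$⟩ b)) (⟨$⟩-involutive π _) ⟩
      transpose (π ⟨$⟩ a) (π ⟨$⟩ b) (transpose a b x)
        ≡⟨ cancels x ⟩
      x ∎)

    swapped-cancels : ∀ π → π ⟨$⟩ a ≡ b → π ⟨$⟩ b ≡ a →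
                      ∀ x → transpose (π ⟨$⟩ a) (π ⟨$⟩ b) (transpose a b x) ≡ x
    swapped-cancels π πa≡b πb≡a x rewrite πa≡b | πb≡a = transpose-inverse b a

    fixed-cancels : ∀ ρ → Fixing a ρ → Fixing b ρ →
                    ∀ x → transpose (ρ ⟨$⟩ a) (ρ ⟨$⟩ b) (transpose a b x) ≡ x
    fixed-cancels ρ ρa≡a ρb≡b x rewrite ρa≡a | ρb≡b = transpose-involutive a b x

  composeTranspose↔ : Σ (Involution n) (λ π → π ⟨$⟩ a ≡ b) ↔ Σ (Σ (Involution n) (Fixing a)) (Fixing b ∘ proj₁)
  composeTranspose↔ = mk↔ₛ′ to from
    (λ ((ρ , _) , _) → Σ-≡-irrelevant uip (Σ-≡-irrelevant uip (Involution-≡ (transposed-twice (proj₁ ρ)))))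
    (λ (π , _) → Σ-≡-irrelevant uip (Involution-≡ (transposed-twice (proj₁ π))))
    where
    to : Σ (Involution n) (λ π → π ⟨$⟩ a ≡ b) → Σ (Σ (Involution n) (Fixing a)) (Fixing b ∘ proj₁)
    to (π , πa≡b) = (composeTranspose π (swapped-cancels π πa≡b πb≡a) , ρa≡a) , ρb≡b
      where
      πb≡a : π ⟨$⟩ b ≡ a
      πb≡a = trans (cong (π ⟨$⟩_) (sym πa≡b)) (⟨$⟩-involutive π a)
      ρa≡a : lookup (transposed (proj₁ π)) a ≡ a
      ρa≡a = trans (lookup-transposed (proj₁ π) a) (trans (cong (π ⟨$⟩_) (transpose-matchˡ a b)) πb≡a)
      ρb≡b : lookup (transposed (proj₁ π)) b ≡ b
      ρb≡b = trans (lookup-transposed (proj₁ π) b) (trans (cong (π ⟨$⟩_) (transpose-matchʳ a b)) πa≡b)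
    from : Σ (Σ (Involution n) (Fixing a)) (Fixing b ∘ proj₁) → Σ (Involution n) (λ π → π ⟨$⟩ a ≡ b)
    from ((ρ , ρa≡a) , ρb≡b) = composeTranspose ρ (fixed-cancels ρ ρa≡a ρb≡b) ,
      trans (lookup-transposed (proj₁ ρ) a) (trans (cong (ρ ⟨$⟩_) (transpose-matchˡ a b)) ρb≡b)

Involution-suc-suc↔ : ∀ k → Involution (suc (suc k)) ↔ (Involution (suc k) ⊎ (Fin (suc k) × Involution k))
Involution-suc-suc↔ k = ↔-trans (fibres↔ (_⟨$⟩ zero)) (removeFixedPoint↔ zero ⊎-↔ Σ-↔ ↔-refl pairedWithZero↔)
  where
  pairedWithZero↔ : ∀ {j} → Σ (Involution (suc (suc k))) (λ π → π ⟨$⟩ zero ≡ suc j) ↔ Involution k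
  pairedWithZero↔ {j} =
    ↔-trans (composeTranspose↔ zero (suc j)) (↔-trans (removeFixedPoint-fixing↔ zero j) (removeFixedPoint↔ j))

numInvolutions-suc-suc : ∀ k → numInvolutions (suc (suc k)) ≡ numInvolutions (suc k) ℕ.+ suc k ℕ.* numInvolutions k
numInvolutions-suc-suc k = ↔⇒≡ (↔-begin
  Fin (numInvolutions (suc (suc k)))
    ↔⟨ Fin-numInvolutions↔ (suc (suc k)) ⟩
  Involution (suc (suc k))
    ↔⟨ Involution-suc-suc↔ k ⟩
  (Involution (suc k) ⊎ (Fin (suc k) × Involution k))
    ↔⟨ Fin-numInvolutions↔ (suc k) ⊎-↔ (↔-refl ×-↔ Fin-numInvolutions↔ k) ⟨
  (Fin (numInvolutions (suc k)) ⊎ (Fin (suc k) × Fin (numInvolutions k)))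
    ↔⟨ ↔-refl ⊎-↔ Fin.*↔× ⟨
  (Fin (numInvolutions (suc k)) ⊎ Fin (suc k ℕ.* numInvolutions k))
    ↔⟨ Fin.+↔⊎ ⟨
  Fin (numInvolutions (suc k) ℕ.+ suc k ℕ.* numInvolutions k) ↔-∎)
  where open Related.EquationalReasoning renaming (begin_ to ↔-begin_; _∎ to _↔-∎)

Fspec≡numInvolutions : ∀ n → Fspec n ≡ + numInvolutions n
Fspec≡numInvolutions 0 = refl
Fspec≡numInvolutions 1 = refl
Fspec≡numInvolutions (suc (suc n)) = begin
  Fspec (suc (suc n))
    ≡⟨ Fspec-suc-suc n ⟩
  Fspec (suc n) + + suc n * Fspec n
    ≡⟨ cong₂ (λ a b → a + + suc n * b) (Fspec≡numInvolutions (suc n)) (Fspec≡numInvolutions n) ⟩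
  + numInvolutions (suc n) + + suc n * + numInvolutions n
    ≡⟨ cong (_+_ (+ numInvolutions (suc n))) (ℤ.pos-* (suc n) (numInvolutions n)) ⟨
  + numInvolutions (suc n) + + (suc n ℕ.* numInvolutions n)
    ≡⟨ ℤ.pos-+ (numInvolutions (suc n)) (suc n ℕ.* numInvolutions n) ⟨
  + (numInvolutions (suc n) ℕ.+ suc n ℕ.* numInvolutions n)
    ≡⟨ cong +_ (numInvolutions-suc-suc n) ⟨
  + numInvolutions (suc (suc n)) ∎

mainTheorem8 : (n : ℕ) → n ≥ 1 → Fspec n ≡ + numInvolutions n
mainTheorem8 n _ = Fspec≡numInvolutions n
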